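{- Let $a$ and $x$ be parameters (indeterminates, or complex numbers for which no denominator below vanishes), and $|q|<1$. For $n\ge 0$ define $$\alpha_n'=\frac{q^{n^2-n}(-x)^n(1-a^2q^{4n})(a^2/x;q^2)_n}{(1-a^2)(q^2x;q^2)_n}\sum_{0\le j\le n}\frac{(1-aq^{2j-1})(a;q)_{j-1}(x;q^2)_j}{q^{j(j-1)/2}x^j(q;q)_j(a^2/x;q^2)_j},$$ $$\beta_n'=\frac{(-1)^nq^{n^2}(1-x)}{(-a;q)_{2n}(q^2;q^2)_n(1-xq^{2n})}.$$ Then $(\alpha_n',\beta_n')$ is a Bailey pair relative to $a^2$ with base $q^2$, i.e. for every $n\ge0$, $$\beta_n'=\sum_{i=0}^{n}\frac{\alpha_i'}{(q^2;q^2)_{n-i}(a^2q^2;q^2)_{n+i}}.$$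
   Context: Notation: $(z;p)_n=\prod_{k=0}^{n-1}(1-zp^k)$ for $n\ge0$, $(z;p)_\infty=\prod_{k\ge0}(1-zp^k)$, and $(z)_n=(z;q)_n$. The convention $(a;q)_{ -1}=1/(1-aq^{ -1})$ is used, so that the $j=0$ term of the inner sum equals $1$. A pair of sequences $(\alpha_n,\beta_n)$ is a Bailey pair relative to $A$ with base $p$ if $\beta_n=\sum_{i=0}^n \alpha_i/((p;p)_{n-i}(Ap;p)_{n+i})$ for all $n\ge0$. -}

module Defs where

open import Level using (Level; _⊔_) renaming (suc to lsuc)
open import Data.Nat using (ℕ; zero; suc; _∸_; _/_) renaming (_+_ to _+ℕ_; _*_ to _*ℕ_)
open import Relation.Nullary using (¬_)
open import Algebra.Bundles using (CommutativeRing)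

record Field (c ℓ : Level) : Set (lsuc (c ⊔ ℓ)) where
  field
    commutativeRing : CommutativeRing c ℓ
  open CommutativeRing commutativeRing public
  field
    _⁻¹      : Carrier → Carrier
    1≉0      : ¬ (1# ≈ 0#)
    ⁻¹-inverse : ∀ y → ¬ (y ≈ 0#) → y * (y ⁻¹) ≈ 1#

module FieldOps {c ℓ : Level} (F : Field c ℓ) where
  open Field F public

  infixl 7 _÷_
  _÷_ : Carrier → Carrier → Carrier
  y ÷ z = y * (z ⁻¹)

  pow : Carrier → ℕ → Carrier
  pow y zero    = 1#
  pow y (suc n) = y * pow y n

  poch : Carrier → Carrier → ℕ → Carrier
  poch z p zero    = 1#
  poch z p (suc n) = poch z p n * (1# - z * pow p n)

  -- Σ_{i=0}^{n} f i  (inclusive upper bound)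
  sumTo : ℕ → (ℕ → Carrier) → Carrier
  sumTo zero    f = f 0
  sumTo (suc n) f = sumTo n f + f (suc n)

  BaileyPair : Carrier → Carrier → (ℕ → Carrier) → (ℕ → Carrier) → Set ℓ
  BaileyPair A p α β =
    ∀ n → β n ≈ sumTo n (λ i → α i ÷ (poch p p (n ∸ i) * poch (A * p) p (n +ℕ i)))

  sq : Carrier → Carrier
  sq y = y * y

  -- j-th summand of the inner sum; the j = 0 term equals 1 by the
  -- convention (a;q)_{-1} = 1/(1 - a q^{-1}).
  innerTerm : (a x q : Carrier) → ℕ → Carrier
  innerTerm a x q zero = 1#
  innerTerm a x q (suc j) =
    ((1# - a * pow q (2 *ℕ suc j ∸ 1)) * poch a q j * poch x (sq q) (suc j))
    ÷ (pow q ((suc j *ℕ j) / 2) * pow x (suc j) * poch q q (suc j)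
       * poch (sq a ÷ x) (sq q) (suc j))

  alpha' : (a x q : Carrier) → ℕ → Carrier
  alpha' a x q n =
    ((pow q (n *ℕ n ∸ n) * pow (- x) n * (1# - sq a * pow q (4 *ℕ n))
       * poch (sq a ÷ x) (sq q) n)
     ÷ ((1# - sq a) * poch (sq q * x) (sq q) n))
    * sumTo n (innerTerm a x q)

  beta' : (a x q : Carrier) → ℕ → Carrier
  beta' a x q n =
    (pow (- 1#) n * pow q (n *ℕ n) * (1# - x))
    ÷ (poch (- a) q (2 *ℕ n) * poch (sq q) (sq q) n * (1# - x * pow q (2 *ℕ n)))

module Submission where

-- Since α′ᵢ = prefactor(i)·Tᵢ, where Tᵢ = Σ_{j≤i} tⱼ
-- is a partial sum of the inner series, the Bailey sum is Σ_{i≤n} Tᵢ·e(n,i).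
--  1. Gosper step: e(n,i) = r(n)·(h(n,i) - h(n,i+1)) for i < n and
--     e(n,n) = r(n)·h(n,n), with r(n) = (1-x)/(1-xq^{2n}).
--  2. Summation by parts turns the Bailey sum into r(n)·Σ_{i≤n} tᵢ·h(n,i).
--  3. tᵢ·h(n,i) = term(n,i), which no longer involves x.
--  4. A WZ pair (term, cert) yields s(n)·Σ term(n+1,·) = -c(n)·Σ term(n,·),
--     the recurrence of β(n) = (-1)ⁿq^{n²}/((-a;q)_{2n}(q²;q²)ₙ); hence
--     Σ_{i≤n} term(n,i) = β(n), and β′ₙ = r(n)·β(n).
-- Every rational identity is proved by writing the terms involved as one
-- common skeleton (a quotient of products) times a polynomial, so that only
-- small polynomial identities are left to the ring solver.

open import Defs
open import Level using (Level)
open import Data.Nat using (ℕ; suc) renaming (_*_ to _*ℕ_)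
open import Relation.Nullary using (¬_)

open import Data.Nat using (zero; z≤n; s≤s; _≤_; _<_; _∸_; _/_) renaming (_+_ to _+ℕ_)
import Data.Nat.Properties as ℕ
open import Data.Nat.DivMod using (m*n/n≡m)
open import Data.Nat.Tactic.RingSolver using (solve-∀)
open import Data.Integer as ℤ using (ℤ; +_; -[1+_]; _⊖_)
import Data.Integer.Properties as ℤ
open import Data.Sign as Sign using (Sign)
open import Data.Maybe using (Maybe; just; nothing)
open import Relation.Nullary using (yes; no)
open import Relation.Binary.PropositionalEquality as ≡ using (_≡_)
open import Algebra.Bundles using (CommutativeRing)
import Algebra.Solver.Ring
import Algebra.Solver.Ring.AlmostCommutativeRing as ACR

-- Algebra.Solver.Ring needs a coefficient ring mapping into R;
-- we use the integers, whose canonical image in R is a ring morphism.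
module IntegerCoefficients {c ℓ : Level} (R : CommutativeRing c ℓ) where
  open CommutativeRing R
  open import Algebra.Properties.Ring ring
    using (-1*x≈-x; -0#≈0#; -‿involutive; -‿+-comm)
  open import Algebra.Properties.Semiring.Mult.TCOptimised semiring
    using (_×_; 1+×; ×-homo-+; ×1-homo-*)
  open import Algebra.Properties.CommutativeSemigroup *-commutativeSemigroup using (interchange)
  open import Relation.Binary.Reasoning.Setoid setoid

  -- the image of an integer; it is definitionally 0# at 0 and 1# at 1
  ⟦_⟧ℤ : ℤ → Carrier
  ⟦ + n ⟧ℤ      = n × 1#
  ⟦ -[1+ n ] ⟧ℤ = - (suc n × 1#)

  ⊖-homo : ∀ m n → ⟦ m ⊖ n ⟧ℤ ≈ m × 1# - n × 1#
  ⊖-homo zero    zero    = sym (-‿inverseʳ 0#)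
  ⊖-homo (suc m) zero    = begin
    ⟦ suc m ⊖ 0 ⟧ℤ   ≈⟨ reflexive (≡.cong ⟦_⟧ℤ (ℤ.⊖-≥ (z≤n {suc m}))) ⟩
    suc m × 1#       ≈⟨ +-identityʳ _ ⟨
    suc m × 1# + 0#  ≈⟨ +-congˡ -0#≈0# ⟨
    suc m × 1# - 0#  ∎
  ⊖-homo zero    (suc n) = sym (+-identityˡ _)
  ⊖-homo (suc m) (suc n) = begin
    ⟦ suc m ⊖ suc n ⟧ℤ        ≈⟨ reflexive (≡.cong ⟦_⟧ℤ (ℤ.[1+m]⊖[1+n]≡m⊖n m n)) ⟩
    ⟦ m ⊖ n ⟧ℤ                ≈⟨ ⊖-homo m n ⟩
    m × 1# - n × 1#           ≈⟨ cancel-1 (m × 1#) (n × 1#) ⟨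
    (1# + m × 1#) - (1# + n × 1#) ≈⟨ +-cong (1+× m 1#) (-‿cong (1+× n 1#)) ⟨
    suc m × 1# - suc n × 1#   ∎
    where
    cancel-1 : ∀ u v → (1# + u) - (1# + v) ≈ u - v
    cancel-1 u v = begin
      (1# + u) - (1# + v)       ≈⟨ +-cong (+-comm u 1#) (-‿+-comm 1# v) ⟨
      (u + 1#) + (- 1# - v)     ≈⟨ +-assoc u 1# _ ⟩
      u + (1# + (- 1# - v))     ≈⟨ +-congˡ (+-assoc 1# (- 1#) _) ⟨
      u + ((1# - 1#) - v)       ≈⟨ +-congˡ (+-congʳ (-‿inverseʳ 1#)) ⟩
      u + (0# - v)              ≈⟨ +-congˡ (+-identityˡ _) ⟩
      u - v                     ∎

  +-homo : ∀ i j → ⟦ i ℤ.+ j ⟧ℤ ≈ ⟦ i ⟧ℤ + ⟦ j ⟧ℤ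
  +-homo (+ m)    (+ n)    = ×-homo-+ 1# m n
  +-homo (+ m)    -[1+ n ] = ⊖-homo m (suc n)
  +-homo -[1+ m ] (+ n)    = trans (⊖-homo n (suc m)) (+-comm _ _)
  +-homo -[1+ m ] -[1+ n ] = begin
    - (suc (suc (m +ℕ n)) × 1#)       ≈⟨ -‿cong (reflexive (≡.cong (λ k → suc k × 1#) (≡.sym (ℕ.+-suc m n)))) ⟩
    - ((suc m +ℕ suc n) × 1#)         ≈⟨ -‿cong (×-homo-+ 1# (suc m) (suc n)) ⟩
    - (suc m × 1# + suc n × 1#)        ≈⟨ -‿+-comm _ _ ⟨
    - (suc m × 1#) - suc n × 1#        ∎

  signValue : Sign → Carrier
  signValue Sign.+ = 1#
  signValue Sign.- = - 1#

  ◃-homo : ∀ s n → ⟦ s ℤ.◃ n ⟧ℤ ≈ signValue s * (n × 1#)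
  ◃-homo s      zero    = sym (zeroʳ _)
  ◃-homo Sign.+ (suc n) = sym (*-identityˡ _)
  ◃-homo Sign.- (suc n) = sym (-1*x≈-x _)

  sign-abs : ∀ i → ⟦ i ⟧ℤ ≈ signValue (ℤ.sign i) * (ℤ.∣ i ∣ × 1#)
  sign-abs (+ n)    = sym (*-identityˡ _)
  sign-abs -[1+ n ] = sym (-1*x≈-x _)

  signValue-homo : ∀ s t → signValue (s Sign.* t) ≈ signValue s * signValue t
  signValue-homo Sign.+ t      = sym (*-identityˡ _)
  signValue-homo Sign.- Sign.+ = sym (*-identityʳ _)
  signValue-homo Sign.- Sign.- = sym (trans (-1*x≈-x (- 1#)) (-‿involutive 1#))

  *-homo : ∀ i j → ⟦ i ℤ.* j ⟧ℤ ≈ ⟦ i ⟧ℤ * ⟦ j ⟧ℤ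
  *-homo i j = begin
    ⟦ i ℤ.* j ⟧ℤ
      ≈⟨ ◃-homo (ℤ.sign i Sign.* ℤ.sign j) (ℤ.∣ i ∣ *ℕ ℤ.∣ j ∣) ⟩
    signValue (ℤ.sign i Sign.* ℤ.sign j) * ((ℤ.∣ i ∣ *ℕ ℤ.∣ j ∣) × 1#)
      ≈⟨ *-cong (signValue-homo (ℤ.sign i) (ℤ.sign j)) (×1-homo-* ℤ.∣ i ∣ ℤ.∣ j ∣) ⟩
    (signValue (ℤ.sign i) * signValue (ℤ.sign j)) * ((ℤ.∣ i ∣ × 1#) * (ℤ.∣ j ∣ × 1#))
      ≈⟨ interchange _ _ _ _ ⟩
    (signValue (ℤ.sign i) * (ℤ.∣ i ∣ × 1#)) * (signValue (ℤ.sign j) * (ℤ.∣ j ∣ × 1#))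
      ≈⟨ *-cong (sign-abs i) (sign-abs j) ⟨
    ⟦ i ⟧ℤ * ⟦ j ⟧ℤ ∎

  neg-homo : ∀ i → ⟦ ℤ.- i ⟧ℤ ≈ - ⟦ i ⟧ℤ
  neg-homo (+ zero)  = sym -0#≈0#
  neg-homo (+ suc n) = refl
  neg-homo -[1+ n ]  = sym (-‿involutive _)

  morphism : ℤ.+-*-rawRing ACR.-Raw-AlmostCommutative⟶ ACR.fromCommutativeRing R
  morphism = record
    { ⟦_⟧    = ⟦_⟧ℤ
    ; +-homo = +-homo
    ; *-homo = *-homo
    ; -‿homo = neg-homo
    ; 0-homo = refl
    ; 1-homo = refl
    }

  decide : ∀ i j → Maybe (⟦ i ⟧ℤ ≈ ⟦ j ⟧ℤ)
  decide i j with i ℤ.≟ j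
  ... | yes ≡.refl = just refl
  ... | no _       = nothing

  open Algebra.Solver.Ring ℤ.+-*-rawRing (ACR.fromCommutativeRing R) morphism decide public

  :1 : ∀ {n} → Polynomial n
  :1 = con (+ 1)

-- Arithmetic of fractions in a field.  Everything reduces to the
-- uniqueness of quotients: w * d ≈ u with d ≠ 0 forces w ≈ u ÷ d.
module FieldArithmetic {c ℓ : Level} (F : Field c ℓ) where
  open FieldOps F
  open import Relation.Binary.Reasoning.Setoid setoid
  open IntegerCoefficients commutativeRing using (solve; _:=_; _:*_)

  NonZero : Carrier → Set ℓ
  NonZero y = ¬ (y ≈ 0#)

  nonZero-resp : ∀ {y z} → y ≈ z → NonZero y → NonZero z
  nonZero-resp y≈z y≉0 z≈0 = y≉0 (trans y≈z z≈0)

  *-nonZero : ∀ {y z} → NonZero y → NonZero z → NonZero (y * z)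
  *-nonZero {y} {z} y≉0 z≉0 yz≈0 = y≉0 (begin
    y                  ≈⟨ *-identityʳ y ⟨
    y * 1#             ≈⟨ *-congˡ (⁻¹-inverse z z≉0) ⟨
    y * (z * z ⁻¹)     ≈⟨ *-assoc y z _ ⟨
    (y * z) * z ⁻¹     ≈⟨ *-congʳ yz≈0 ⟩
    0# * z ⁻¹          ≈⟨ zeroˡ _ ⟩
    0#                 ∎)

  ÷-cancelʳ : ∀ {u d} → NonZero d → (u ÷ d) * d ≈ u
  ÷-cancelʳ {u} {d} d≉0 = begin
    (u * d ⁻¹) * d  ≈⟨ *-assoc u _ d ⟩
    u * (d ⁻¹ * d)  ≈⟨ *-congˡ (*-comm _ d) ⟩
    u * (d * d ⁻¹)  ≈⟨ *-congˡ (⁻¹-inverse d d≉0) ⟩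
    u * 1#          ≈⟨ *-identityʳ u ⟩
    u               ∎

  ÷-unique : ∀ {w u d} → NonZero d → w * d ≈ u → w ≈ u ÷ d
  ÷-unique {w} {u} {d} d≉0 wd≈u = begin
    w                  ≈⟨ *-identityʳ w ⟨
    w * 1#             ≈⟨ *-congˡ (⁻¹-inverse d d≉0) ⟨
    w * (d * d ⁻¹)     ≈⟨ *-assoc w d _ ⟨
    (w * d) * d ⁻¹     ≈⟨ *-congʳ wd≈u ⟩
    u ÷ d              ∎

  *-cancelʳ : ∀ {u v d} → NonZero d → u * d ≈ v * d → u ≈ v
  *-cancelʳ {u} {v} d≉0 ud≈vd =
    trans (÷-unique d≉0 ud≈vd) (sym (÷-unique d≉0 refl))

  *-cancelˡ : ∀ {u v d} → NonZero d → d * u ≈ d * v → u ≈ v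
  *-cancelˡ {u} {v} {d} d≉0 du≈dv = *-cancelʳ d≉0 (trans (*-comm u d) (trans du≈dv (*-comm d v)))

  ÷-congˡ : ∀ {u v d} → u ≈ v → u ÷ d ≈ v ÷ d
  ÷-congˡ = *-congʳ

  ÷-congʳ : ∀ {u d e} → NonZero d → d ≈ e → u ÷ d ≈ u ÷ e
  ÷-congʳ d≉0 d≈e = ÷-unique (nonZero-resp d≈e d≉0)
    (trans (*-congˡ (sym d≈e)) (÷-cancelʳ d≉0))

  ÷-≈ : ∀ {u v b d} → NonZero b → NonZero d → u * d ≈ v * b → u ÷ b ≈ v ÷ d
  ÷-≈ {u} {v} {b} {d} b≉0 d≉0 ud≈vb = ÷-unique d≉0 (*-cancelʳ b≉0 (begin
    (u ÷ b) * d * b    ≈⟨ rearrange (u ÷ b) d b ⟩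
    ((u ÷ b) * b) * d  ≈⟨ *-congʳ (÷-cancelʳ b≉0) ⟩
    u * d              ≈⟨ ud≈vb ⟩
    v * b              ∎))
    where
    rearrange : ∀ s d b → s * d * b ≈ (s * b) * d
    rearrange = solve 3 (λ s d b → s :* d :* b := (s :* b) :* d) refl

  ÷-*-÷ : ∀ {u v b d} → NonZero b → NonZero d → (u ÷ b) * (v ÷ d) ≈ (u * v) ÷ (b * d)
  ÷-*-÷ {u} {v} {b} {d} b≉0 d≉0 = ÷-unique (*-nonZero b≉0 d≉0) (begin
    (u ÷ b) * (v ÷ d) * (b * d)      ≈⟨ rearrange (u ÷ b) (v ÷ d) b d ⟩
    ((u ÷ b) * b) * ((v ÷ d) * d)    ≈⟨ *-cong (÷-cancelʳ b≉0) (÷-cancelʳ d≉0) ⟩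
    u * v                            ∎)
    where
    rearrange : ∀ s t b d → s * t * (b * d) ≈ (s * b) * (t * d)
    rearrange = solve 4 (λ s t b d → s :* t :* (b :* d) := (s :* b) :* (t :* d)) refl

  ÷-÷ : ∀ {u b d} → NonZero b → NonZero d → (u ÷ b) ÷ d ≈ u ÷ (b * d)
  ÷-÷ {u} {b} {d} b≉0 d≉0 = ÷-unique (*-nonZero b≉0 d≉0) (begin
    ((u ÷ b) ÷ d) * (b * d)    ≈⟨ rearrange ((u ÷ b) ÷ d) b d ⟩
    (((u ÷ b) ÷ d) * d) * b    ≈⟨ *-congʳ (÷-cancelʳ d≉0) ⟩
    (u ÷ b) * b                ≈⟨ ÷-cancelʳ b≉0 ⟩
    u                          ∎)
    where
    rearrange : ∀ s b d → s * (b * d) ≈ (s * d) * b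
    rearrange = solve 3 (λ s b d → s :* (b :* d) := (s :* d) :* b) refl

  -- Pulling a common factor N₀ ÷ D₀ out of a quotient N ÷ D: the
  -- workhorse for writing hypergeometric terms over a common skeleton.
  ÷-factor : ∀ {N D N₀ D₀ u v} → NonZero D → NonZero D₀ →
             N ≈ N₀ * u → D₀ ≈ D * v → N ÷ D ≈ (N₀ ÷ D₀) * (u * v)
  ÷-factor {N} {D} {N₀} {D₀} {u} {v} D≉0 D₀≉0 N≈ D₀≈ = sym (÷-unique D≉0 (begin
    (N₀ ÷ D₀) * (u * v) * D    ≈⟨ rearrange (N₀ ÷ D₀) u v D ⟩
    ((N₀ ÷ D₀) * (D * v)) * u  ≈⟨ *-congʳ (*-congˡ D₀≈) ⟨
    ((N₀ ÷ D₀) * D₀) * u       ≈⟨ *-congʳ (÷-cancelʳ D₀≉0) ⟩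
    N₀ * u                     ≈⟨ N≈ ⟨
    N                          ∎))
    where
    rearrange : ∀ s u v D → s * (u * v) * D ≈ (s * (D * v)) * u
    rearrange = solve 4 (λ s u v D → s :* (u :* v) :* D := (s :* (D :* v)) :* u) refl

  ÷-extend : ∀ {N D D₀ v} → NonZero D → NonZero D₀ → D₀ ≈ D * v → N ÷ D ≈ (N ÷ D₀) * v
  ÷-extend {N} {D} {D₀} {v} D≉0 D₀≉0 D₀≈ =
    trans (÷-factor D≉0 D₀≉0 (sym (*-identityʳ N)) D₀≈) (*-congˡ (*-identityˡ v))

  ÷-cancel-inside : ∀ {u d σ W} → NonZero d → (u ÷ d) * (σ * (d * W)) ≈ σ * (W * u)
  ÷-cancel-inside {u} {d} {σ} {W} d≉0 = begin
    (u ÷ d) * (σ * (d * W))    ≈⟨ rearrange (u ÷ d) σ d W ⟩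
    σ * (W * ((u ÷ d) * d))    ≈⟨ *-congˡ (*-congˡ (÷-cancelʳ d≉0)) ⟩
    σ * (W * u)                ∎
    where
    rearrange : ∀ s σ d W → s * (σ * (d * W)) ≈ σ * (W * (s * d))
    rearrange = solve 4 (λ s σ d W → s :* (σ :* (d :* W)) := σ :* (W :* (s :* d))) refl

module PowersAndPochhammer {c ℓ : Level} (F : Field c ℓ) where
  open FieldOps F
  open FieldArithmetic F using (NonZero; *-nonZero)
  open import Algebra.Properties.CommutativeSemigroup *-commutativeSemigroup using (interchange)
  open import Relation.Binary.Reasoning.Setoid setoid
  open IntegerCoefficients commutativeRing using (solve; _:=_; _:*_; _:-_; :1)

  pow-cong : ∀ y {m n} → m ≡ n → pow y m ≈ pow y n
  pow-cong y m≡n = reflexive (≡.cong (pow y) m≡n)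

  pow-congˡ : ∀ {y z} n → y ≈ z → pow y n ≈ pow z n
  pow-congˡ zero    y≈z = refl
  pow-congˡ (suc n) y≈z = *-cong y≈z (pow-congˡ n y≈z)

  pow-+ : ∀ y m n → pow y (m +ℕ n) ≈ pow y m * pow y n
  pow-+ y zero    n = sym (*-identityˡ _)
  pow-+ y (suc m) n = trans (*-congˡ (pow-+ y m n)) (sym (*-assoc y _ _))

  pow-* : ∀ y z n → pow (y * z) n ≈ pow y n * pow z n
  pow-* y z zero    = sym (*-identityˡ 1#)
  pow-* y z (suc n) = trans (*-congˡ (pow-* y z n)) (interchange y z _ _)

  pow-double : ∀ y n → pow y (2 *ℕ n) ≈ pow y n * pow y n
  pow-double y n = trans (pow-+ y n (n +ℕ 0)) (*-congˡ (pow-cong y (ℕ.+-identityʳ n)))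

  pow-split : ∀ y {i n} → i ≤ n → pow y n ≈ pow y i * pow y (n ∸ i)
  pow-split y {i} i≤n = trans (pow-cong y (≡.sym (ℕ.m+[n∸m]≡n i≤n))) (pow-+ y i _)

  pow-nonZero : ∀ {y} n → NonZero y → NonZero (pow y n)
  pow-nonZero zero    y≉0 = 1≉0
  pow-nonZero (suc n) y≉0 = *-nonZero y≉0 (pow-nonZero n y≉0)

  poch-nonZero : ∀ {z p} → (∀ k → NonZero (1# - z * pow p k)) → ∀ n → NonZero (poch z p n)
  poch-nonZero factor≉0 zero    = 1≉0
  poch-nonZero factor≉0 (suc n) = *-nonZero (poch-nonZero factor≉0 n) (factor≉0 n)

  poch-cong : ∀ {z z′} p n → z ≈ z′ → poch z p n ≈ poch z′ p n
  poch-cong p zero    z≈z′ = refl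
  poch-cong p (suc n) z≈z′ = *-cong (poch-cong p n z≈z′) (+-congˡ (-‿cong (*-congʳ z≈z′)))

  poch-shift : ∀ z p n → poch z p (suc n) ≈ (1# - z) * poch (z * p) p n
  poch-shift z p zero    = solve 1 (λ z → :1 :* (:1 :- z :* :1) := (:1 :- z) :* :1) refl z
  poch-shift z p (suc n) = begin
    poch z p (suc n) * (1# - z * (p * pow p n))
      ≈⟨ *-cong (poch-shift z p n) (+-congˡ (-‿cong (sym (*-assoc z p _)))) ⟩
    ((1# - z) * poch (z * p) p n) * (1# - (z * p) * pow p n)
      ≈⟨ *-assoc _ _ _ ⟩
    (1# - z) * poch (z * p) p (suc n) ∎

module FiniteSums {c ℓ : Level} (F : Field c ℓ) where
  open FieldOps F
  open import Relation.Binary.Reasoning.Setoid setoid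
  open IntegerCoefficients commutativeRing using (solve; _:=_; _:*_; _:+_; _:-_; :-_; con)

  sum-cong : ∀ n {f g : ℕ → Carrier} → (∀ i → i ≤ n → f i ≈ g i) → sumTo n f ≈ sumTo n g
  sum-cong zero    f≈g = f≈g 0 z≤n
  sum-cong (suc n) f≈g =
    +-cong (sum-cong n (λ i i≤n → f≈g i (ℕ.m≤n⇒m≤1+n i≤n))) (f≈g (suc n) ℕ.≤-refl)

  sum-*ˡ : ∀ n s (f : ℕ → Carrier) → sumTo n (λ i → s * f i) ≈ s * sumTo n f
  sum-*ˡ zero    s f = refl
  sum-*ˡ (suc n) s f = trans (+-congʳ (sum-*ˡ n s f)) (sym (distribˡ s _ _))

  sum-- : ∀ n (f g : ℕ → Carrier) → sumTo n (λ i → f i - g i) ≈ sumTo n f - sumTo n g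
  sum-- zero    f g = refl
  sum-- (suc n) f g = trans (+-congʳ (sum-- n f g)) (regroup _ _ _ _)
    where
    regroup : ∀ u v w z → (u - v) + (w - z) ≈ (u + w) - (v + z)
    regroup = solve 4 (λ u v w z → (u :- v) :+ (w :- z) := (u :+ w) :- (v :+ z)) refl

  telescope : ∀ n (g : ℕ → Carrier) → sumTo n (λ j → g (suc j) - g j) ≈ g (suc n) - g 0
  telescope zero    g = refl
  telescope (suc n) g = trans (+-congʳ (telescope n g)) (collapse _ _ _)
    where
    collapse : ∀ u v w → (v - w) + (u - v) ≈ u - w
    collapse = solve 3 (λ u v w → (v :- w) :+ (u :- v) := u :- w) refl

  abel : ∀ n (t H : ℕ → Carrier) →
         sumTo n (λ i → sumTo i t * (H i - H (suc i)))
           ≈ sumTo n (λ i → t i * H i) - sumTo n t * H (suc n)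
  abel zero    t H = solve 3 (λ t h₀ h₁ → t :* (h₀ :- h₁) := t :* h₀ :- t :* h₁) refl _ _ _
  abel (suc n) t H = trans (+-congʳ (abel n t H)) (regroup _ _ _ _ _)
    where
    regroup : ∀ Σ T t h₁ h₂ → (Σ - T * h₁) + (T + t) * (h₁ - h₂) ≈ (Σ + t * h₁) - (T + t) * h₂
    regroup = solve 5 (λ Σ T t h₁ h₂ →
      (Σ :- T :* h₁) :+ (T :+ t) :* (h₁ :- h₂) := (Σ :+ t :* h₁) :- (T :+ t) :* h₂) refl

  summation-by-parts : ∀ n (t e H : ℕ → Carrier) →
    (∀ i → i < n → e i ≈ H i - H (suc i)) → e n ≈ H n →
    sumTo n (λ i → sumTo i t * e i) ≈ sumTo n (λ i → t i * H i)
  summation-by-parts zero    t e H _    e₀≈H₀ = *-congˡ e₀≈H₀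
  summation-by-parts (suc n) t e H diff top = begin
    sumTo n (λ i → sumTo i t * e i) + sumTo (suc n) t * e (suc n)
      ≈⟨ +-cong (sum-cong n (λ i i≤n → *-congˡ (diff i (s≤s i≤n)))) (*-congˡ top) ⟩
    sumTo n (λ i → sumTo i t * (H i - H (suc i))) + (sumTo n t + t (suc n)) * H (suc n)
      ≈⟨ +-congʳ (abel n t H) ⟩
    (sumTo n (λ i → t i * H i) - sumTo n t * H (suc n)) + (sumTo n t + t (suc n)) * H (suc n)
      ≈⟨ regroup _ _ _ _ ⟩
    sumTo n (λ i → t i * H i) + t (suc n) * H (suc n) ∎
    where
    regroup : ∀ Σ T t h → (Σ - T * h) + (T + t) * h ≈ Σ + t * h
    regroup = solve 4 (λ Σ T t h → (Σ :- T :* h) :+ (T :+ t) :* h := Σ :+ t :* h) refl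

  creative-telescoping : ∀ n (f f′ g : ℕ → Carrier) (s c : Carrier) →
    (∀ j → j ≤ n → s * f′ j + c * f j ≈ g (suc j) - g j) →
    g 0 ≈ 0# → s * f′ (suc n) ≈ - g (suc n) →
    s * sumTo (suc n) f′ ≈ - (c * sumTo n f)
  creative-telescoping n f f′ g s c step g₀≈0 top = begin
    s * (sumTo n f′ + f′ (suc n))
      ≈⟨ distribˡ s _ _ ⟩
    s * sumTo n f′ + s * f′ (suc n)
      ≈⟨ +-cong (sym (sum-*ˡ n s f′)) top ⟩
    sumTo n (λ j → s * f′ j) - g (suc n)
      ≈⟨ +-congʳ (sum-cong n (λ j j≤n → isolate (step j j≤n))) ⟩
    sumTo n (λ j → (g (suc j) - g j) - c * f j) - g (suc n)
      ≈⟨ +-congʳ (sum-- n _ _) ⟩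
    (sumTo n (λ j → g (suc j) - g j) - sumTo n (λ j → c * f j)) - g (suc n)
      ≈⟨ +-congʳ (+-cong (telescope n g) (-‿cong (sum-*ˡ n c f))) ⟩
    ((g (suc n) - g 0) - c * sumTo n f) - g (suc n)
      ≈⟨ +-congʳ (+-congʳ (+-congˡ (-‿cong g₀≈0))) ⟩
    ((g (suc n) - 0#) - c * sumTo n f) - g (suc n)
      ≈⟨ collapse _ _ ⟩
    - (c * sumTo n f) ∎
    where
    isolate : ∀ {u v w} → u + v ≈ w → u ≈ w - v
    isolate {u} {v} {w} u+v≈w = trans (solve 2 (λ u v → u := (u :+ v) :- v) refl u v) (+-congʳ u+v≈w)
    collapse : ∀ G S → ((G - 0#) - S) - G ≈ - S
    collapse = solve 2 (λ G S → ((G :- con (+ 0)) :- S) :- G := :- S) refl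

-- Exponents of the form m(m-1)/2 are handled
-- through the binomial coefficient (m choose 2), defined by its Pascal
-- recursion so that (m+1 choose 2) = m + (m choose 2) holds definitionally.
module ExponentArithmetic where
  open ≡.≡-Reasoning

  choose₂ : ℕ → ℕ
  choose₂ zero    = zero
  choose₂ (suc m) = m +ℕ choose₂ m

  choose₂-double : ∀ m → choose₂ (suc m) +ℕ choose₂ (suc m) ≡ suc m *ℕ m
  choose₂-double zero    = ≡.refl
  choose₂-double (suc m) = begin
    (suc m +ℕ c) +ℕ (suc m +ℕ c)  ≡⟨ regroup (suc m) c ⟩
    (suc m +ℕ suc m) +ℕ (c +ℕ c)  ≡⟨ ≡.cong (suc m +ℕ suc m +ℕ_) (choose₂-double m) ⟩
    (suc m +ℕ suc m) +ℕ suc m *ℕ m ≡⟨ expand m ⟩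
    suc (suc m) *ℕ suc m          ∎
    where
    c = choose₂ (suc m)
    regroup : ∀ k c → (k +ℕ c) +ℕ (k +ℕ c) ≡ (k +ℕ k) +ℕ (c +ℕ c)
    regroup = solve-∀
    expand : ∀ m → (suc m +ℕ suc m) +ℕ suc m *ℕ m ≡ suc (suc m) *ℕ suc m
    expand = solve-∀

  halve : ∀ j → (suc j *ℕ j) / 2 ≡ choose₂ (suc j)
  halve j = begin
    (suc j *ℕ j) / 2        ≡⟨ ≡.cong (_/ 2) (≡.sym (choose₂-double j)) ⟩
    (c +ℕ c) / 2            ≡⟨ ≡.cong (_/ 2) (twice c) ⟩
    (c *ℕ 2) / 2            ≡⟨ m*n/n≡m c 2 ⟩
    c                       ∎
    where
    c = choose₂ (suc j)
    twice : ∀ c → c +ℕ c ≡ c *ℕ 2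
    twice = solve-∀

  square-minus : ∀ m → m *ℕ m ∸ m ≡ choose₂ m +ℕ choose₂ m
  square-minus zero    = ≡.refl
  square-minus (suc m) = begin
    suc m *ℕ suc m ∸ suc m       ≡⟨ ≡.cong (_∸ suc m) (ℕ.*-suc (suc m) m) ⟩
    suc m +ℕ suc m *ℕ m ∸ suc m  ≡⟨ ℕ.m+n∸m≡n (suc m) (suc m *ℕ m) ⟩
    suc m *ℕ m                   ≡⟨ choose₂-double m ⟨
    choose₂ (suc m) +ℕ choose₂ (suc m) ∎

  square-minus-suc : ∀ m → suc m *ℕ suc m ∸ suc m ≡ (m *ℕ m ∸ m) +ℕ (m +ℕ m)
  square-minus-suc m = begin
    suc m *ℕ suc m ∸ suc m                   ≡⟨ square-minus (suc m) ⟩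
    (m +ℕ choose₂ m) +ℕ (m +ℕ choose₂ m)     ≡⟨ regroup m (choose₂ m) ⟩
    (choose₂ m +ℕ choose₂ m) +ℕ (m +ℕ m)     ≡⟨ ≡.cong (_+ℕ (m +ℕ m)) (square-minus m) ⟨
    (m *ℕ m ∸ m) +ℕ (m +ℕ m)                 ∎
    where
    regroup : ∀ m c → (m +ℕ c) +ℕ (m +ℕ c) ≡ (c +ℕ c) +ℕ (m +ℕ m)
    regroup = solve-∀

  odd : ∀ j → 2 *ℕ suc j ∸ 1 ≡ suc (j +ℕ j)
  odd j = ≡.cong (_∸ 1) (double-suc j)
    where
    double-suc : ∀ j → 2 *ℕ suc j ≡ suc (suc (j +ℕ j))
    double-suc = solve-∀

  ∸-peel : ∀ {i n} → i < n → n ∸ i ≡ suc (n ∸ suc i)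
  ∸-peel {zero}  {suc n} _           = ≡.refl
  ∸-peel {suc i} {suc n} (s≤s i<n) = ∸-peel i<n

module BaileyPairProof {f ℓ : Level} (F : Field f ℓ) where
  open FieldOps F
  open FieldArithmetic F
  open PowersAndPochhammer F
  open FiniteSums F
  open ExponentArithmetic
  open IntegerCoefficients commutativeRing using (solve; _:=_; _:*_; _:+_; _:-_; :-_; :1; con)
  open import Algebra.Properties.Ring ring using (x[y-z]≈xy-xz; -1*x≈-x; -0#≈0#; -‿distribʳ-*)
  open import Algebra.Properties.CommutativeSemigroup *-commutativeSemigroup using (x∙yz≈y∙xz)
  open import Relation.Binary.Reasoning.Setoid setoid

  one-minus-cong : ∀ {k y z} → y ≈ z → 1# - k * y ≈ 1# - k * z
  one-minus-cong y≈z = +-congˡ (-‿cong (*-congˡ y≈z))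

  module _ (a x q : Carrier)
    (q≉0 : NonZero q)
    (x≉0 : NonZero x)
    (1-a²≉0 : NonZero (1# - sq a))
    (pxFactor≉0 : ∀ k → NonZero (1# - (sq q * x) * pow (sq q) k))
    (xFactor≉0 : ∀ n → NonZero (1# - x * pow q (2 *ℕ n)))
    (qFactor≉0 : ∀ k → NonZero (1# - q * pow q k))
    (pFactor≉0 : ∀ k → NonZero (1# - sq q * pow (sq q) k))
    (wFactor≉0 : ∀ k → NonZero (1# - (sq a ÷ x) * pow (sq q) k))
    (-aFactor≉0 : ∀ k → NonZero (1# - (- a) * pow q k))
    (ApFactor≉0 : ∀ k → NonZero (1# - (sq a * sq q) * pow (sq q) k))
    where

    p A w : Carrier
    p = sq q
    A = sq a
    w = A ÷ x

    -- q^{2n}, the form in which powers of p = q² appear in β′ₙ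
    X : ℕ → Carrier
    X n = pow q (2 *ℕ n)

    X≈pow-p : ∀ n → X n ≈ pow p n
    X≈pow-p n = trans (pow-double q n) (sym (pow-* q q n))

    pow-q-4* : ∀ i → pow q (4 *ℕ i) ≈ pow p i * pow p i
    pow-q-4* i = begin
      pow q (4 *ℕ i)           ≈⟨ pow-cong q (four i) ⟩
      pow q (2 *ℕ (2 *ℕ i))    ≈⟨ X≈pow-p (2 *ℕ i) ⟩
      pow p (2 *ℕ i)           ≈⟨ pow-double p i ⟩
      pow p i * pow p i        ∎
      where
      four : ∀ i → 4 *ℕ i ≡ 2 *ℕ (2 *ℕ i)
      four = solve-∀

    -- the only relation between w = a²/x and x used below
    w*x≈A : w * x ≈ A
    w*x≈A = ÷-cancelʳ x≉0

    poch-p≉0 : ∀ n → NonZero (poch p p n)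
    poch-p≉0 = poch-nonZero pFactor≉0

    poch-Ap≉0 : ∀ n → NonZero (poch (A * p) p n)
    poch-Ap≉0 = poch-nonZero ApFactor≉0

    poch-A≉0 : ∀ n → NonZero (poch A p n)
    poch-A≉0 = poch-nonZero factor≉0
      where
      factor≉0 : ∀ k → NonZero (1# - A * pow p k)
      factor≉0 zero    = nonZero-resp (+-congˡ (-‿cong (sym (*-identityʳ A)))) 1-a²≉0
      factor≉0 (suc k) = nonZero-resp (+-congˡ (-‿cong (*-assoc A p _))) (ApFactor≉0 k)

    poch-x≉0 : ∀ n → NonZero (poch x p n)
    poch-x≉0 = poch-nonZero (λ k → nonZero-resp (one-minus-cong (X≈pow-p k)) (xFactor≉0 k))

    poch-px≉0 : ∀ n → NonZero (poch (p * x) p n)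
    poch-px≉0 = poch-nonZero pxFactor≉0

    poch-w≉0 : ∀ n → NonZero (poch w p n)
    poch-w≉0 = poch-nonZero wFactor≉0

    poch-q≉0 : ∀ n → NonZero (poch q q n)
    poch-q≉0 = poch-nonZero qFactor≉0

    poch--a≉0 : ∀ n → NonZero (poch (- a) q n)
    poch--a≉0 = poch-nonZero -aFactor≉0

    t : ℕ → Carrier
    t = innerTerm a x q

    prefactor : ℕ → Carrier
    prefactor i = (pow q (i *ℕ i ∸ i) * pow (- x) i * (1# - A * pow q (4 *ℕ i)) * poch w p i)
                  ÷ ((1# - A) * poch (p * x) p i)

    baileyDen : ℕ → ℕ → Carrier
    baileyDen n i = poch p p (n ∸ i) * poch (A * p) p (n +ℕ i)

    e : ℕ → ℕ → Carrier
    e n i = prefactor i ÷ baileyDen n i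

    summand≈ : ∀ n i → alpha' a x q i ÷ baileyDen n i ≈ sumTo i t * e n i
    summand≈ n i = solve 3 (λ u S d → (u :* S) :* d := S :* (u :* d)) refl
      (prefactor i) (sumTo i t) (baileyDen n i ⁻¹)

    -- All three terms are polynomial multiples of the skeleton σ, which has
    -- the denominator (x;q²)ᵢ₊₁(q²;q²)_{n-i}(a²;q²)_{n+i+1}.
    r : ℕ → Carrier
    r n = (1# - x) ÷ (1# - x * X n)

    gosperNum : ℕ → Carrier
    gosperNum i = poch w p i * pow (- x) i * pow q (i *ℕ i ∸ i)

    hDen σDen : ℕ → ℕ → Carrier
    hDen n i = poch x p i * poch p p (n ∸ i) * poch A p (n +ℕ i)
    σDen n i = poch x p (suc i) * poch p p (n ∸ i) * poch A p (suc (n +ℕ i))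

    h σ : ℕ → ℕ → Carrier
    h n i = gosperNum i ÷ hDen n i
    σ n i = gosperNum i ÷ σDen n i

    hDen≉0 : ∀ n i → NonZero (hDen n i)
    hDen≉0 n i = *-nonZero (*-nonZero (poch-x≉0 i) (poch-p≉0 (n ∸ i))) (poch-A≉0 (n +ℕ i))

    σDen≉0 : ∀ n i → NonZero (σDen n i)
    σDen≉0 n i = *-nonZero (*-nonZero (poch-x≉0 (suc i)) (poch-p≉0 (n ∸ i))) (poch-A≉0 (suc (n +ℕ i)))

    baileyDen≉0 : ∀ n i → NonZero (baileyDen n i)
    baileyDen≉0 n i = *-nonZero (poch-p≉0 (n ∸ i)) (poch-Ap≉0 (n +ℕ i))

    e-skeleton : ∀ n i → e n i ≈ σ n i * ((1# - A * (pow p i * pow p i)) * (1# - x))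
    e-skeleton n i = begin
      e n i                                    ≈⟨ ÷-÷ prefactorDen≉0 (baileyDen≉0 n i) ⟩
      _ ÷ ((1# - A) * poch (p * x) p i * baileyDen n i)
        ≈⟨ ÷-factor (*-nonZero prefactorDen≉0 (baileyDen≉0 n i)) (σDen≉0 n i) num≈ den≈ ⟩
      σ n i * ((1# - A * (pow p i * pow p i)) * (1# - x)) ∎
      where
      prefactorDen≉0 = *-nonZero 1-a²≉0 (poch-px≉0 i)
      num≈ : pow q (i *ℕ i ∸ i) * pow (- x) i * (1# - A * pow q (4 *ℕ i)) * poch w p i
             ≈ gosperNum i * (1# - A * (pow p i * pow p i))
      num≈ = trans (*-congʳ (*-congˡ (one-minus-cong (pow-q-4* i))))
                   (solve 4 (λ T V L C → T :* V :* L :* C := (C :* V :* T) :* L) refl _ _ _ _)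
      den≈ : σDen n i ≈ (1# - A) * poch (p * x) p i * baileyDen n i * (1# - x)
      den≈ = trans (*-cong (*-congʳ (trans (poch-shift x p i) (*-congˡ (poch-cong p i (*-comm x p)))))
                           (poch-shift A p (n +ℕ i)))
                   (solve 5 (λ lx Cx P2 lA CA → ((lx :* Cx) :* P2) :* (lA :* CA)
                                               := ((lA :* Cx) :* (P2 :* CA)) :* lx) refl _ _ _ _ _)

    h-skeleton : ∀ n i → h n i ≈ σ n i * ((1# - x * pow p i) * (1# - A * pow p (n +ℕ i)))
    h-skeleton n i = ÷-extend (hDen≉0 n i) (σDen≉0 n i)
      (solve 5 (λ Cx lx P2 CA lA → ((Cx :* lx) :* P2) :* (CA :* lA)
                                  := ((Cx :* P2) :* CA) :* (lx :* lA)) refl _ _ _ _ _)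

    poch-p-peel : ∀ {n i} → i < n → poch p p (n ∸ i) ≈ poch p p (n ∸ suc i) * (1# - pow p (n ∸ i))
    poch-p-peel {n} {i} i<n rewrite ∸-peel i<n = refl

    h-next-skeleton : ∀ n i → i < n →
      h n (suc i) ≈ σ n i * ((A * (pow p i * pow p i) - x * pow p i) * (1# - pow p (n ∸ i)))
    h-next-skeleton n i i<n = ÷-factor (hDen≉0 n (suc i)) (σDen≉0 n i) num≈ den≈
      where
      P = pow p i
      q-exponent : pow q (suc i *ℕ suc i ∸ suc i) ≈ pow q (i *ℕ i ∸ i) * P
      q-exponent = begin
        pow q (suc i *ℕ suc i ∸ suc i)         ≈⟨ pow-cong q (square-minus-suc i) ⟩
        pow q ((i *ℕ i ∸ i) +ℕ (i +ℕ i))        ≈⟨ pow-+ q (i *ℕ i ∸ i) (i +ℕ i) ⟩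
        pow q (i *ℕ i ∸ i) * pow q (i +ℕ i)     ≈⟨ *-congˡ (trans (pow-+ q i i) (sym (pow-* q q i))) ⟩
        pow q (i *ℕ i ∸ i) * P                 ∎
      num≈ : gosperNum (suc i) ≈ gosperNum i * (A * (P * P) - x * P)
      num≈ = begin
        poch w p i * (1# - w * P) * (- x * pow (- x) i) * pow q (suc i *ℕ suc i ∸ suc i)
          ≈⟨ *-congˡ q-exponent ⟩
        poch w p i * (1# - w * P) * (- x * pow (- x) i) * (pow q (i *ℕ i ∸ i) * P)
          ≈⟨ solve 6 (λ C w P x V T → C :* (:1 :- w :* P) :* (:- x :* V) :* (T :* P)
                                      := (C :* V :* T) :* ((w :* x) :* (P :* P) :- x :* P)) refl _ _ _ _ _ _ ⟩
        gosperNum i * ((w * x) * (P * P) - x * P)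
          ≈⟨ *-congˡ (+-congʳ (*-congʳ w*x≈A)) ⟩
        gosperNum i * (A * (P * P) - x * P) ∎
      den≈ : σDen n i ≈ hDen n (suc i) * (1# - pow p (n ∸ i))
      den≈ = trans (*-cong (*-congˡ (poch-p-peel i<n)) (reflexive (≡.cong (poch A p) (≡.sym (ℕ.+-suc n i)))))
                   (solve 4 (λ Cx P2 lY CA → Cx :* (P2 :* lY) :* CA := (Cx :* P2 :* CA) :* lY) refl _ _ _ _)

    -- the polynomial identity behind Gosper's step, with P = p^i, Y = p^{n-i}
    gosper-identity : ∀ A x P Y →
      (1# - x * P) * (1# - A * ((P * Y) * P)) - (A * (P * P) - x * P) * (1# - Y)
        ≈ (1# - x * (P * Y)) * (1# - A * (P * P))
    gosper-identity = solve 4 (λ A x P Y →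
      (:1 :- x :* P) :* (:1 :- A :* ((P :* Y) :* P)) :- (A :* (P :* P) :- x :* P) :* (:1 :- Y)
        := (:1 :- x :* (P :* Y)) :* (:1 :- A :* (P :* P))) refl

    gosper-step : ∀ n i → i < n → e n i ≈ r n * (h n i - h n (suc i))
    gosper-step n i i<n = sym (begin
      r n * (h n i - h n (suc i))
        ≈⟨ *-congˡ (+-cong (h-skeleton n i) (-‿cong (h-next-skeleton n i i<n))) ⟩
      r n * (σ n i * U₁ - σ n i * U₂)      ≈⟨ *-congˡ (x[y-z]≈xy-xz (σ n i) U₁ U₂) ⟨
      r n * (σ n i * (U₁ - U₂))            ≈⟨ *-congˡ (*-congˡ difference) ⟩
      r n * (σ n i * ((1# - x * X n) * W))  ≈⟨ ÷-cancel-inside (xFactor≉0 n) ⟩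
      σ n i * (W * (1# - x))               ≈⟨ e-skeleton n i ⟨
      e n i                                ∎)
      where
      P = pow p i
      Y = pow p (n ∸ i)
      W = 1# - A * (P * P)
      U₁ = (1# - x * P) * (1# - A * pow p (n +ℕ i))
      U₂ = (A * (P * P) - x * P) * (1# - Y)
      pow-p-n : pow p n ≈ P * Y
      pow-p-n = pow-split p (ℕ.<⇒≤ i<n)
      difference : U₁ - U₂ ≈ (1# - x * X n) * W
      difference = begin
        U₁ - U₂
          ≈⟨ +-congʳ (*-congˡ (one-minus-cong (trans (pow-+ p n i) (*-congʳ pow-p-n)))) ⟩
        (1# - x * P) * (1# - A * ((P * Y) * P)) - U₂ ≈⟨ gosper-identity A x P Y ⟩
        (1# - x * (P * Y)) * W                     ≈⟨ *-congʳ (one-minus-cong (trans (X≈pow-p n) pow-p-n)) ⟨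
        (1# - x * X n) * W                         ∎

    gosper-top : ∀ n → e n n ≈ r n * h n n
    gosper-top n = sym (begin
      r n * h n n
        ≈⟨ *-congˡ (h-skeleton n n) ⟩
      r n * (σ n n * ((1# - x * P) * (1# - A * pow p (n +ℕ n))))
        ≈⟨ *-congˡ (*-congˡ (*-cong (one-minus-cong (X≈pow-p n)) (one-minus-cong (sym (pow-+ p n n))))) ⟨
      r n * (σ n n * ((1# - x * X n) * (1# - A * (P * P))))
        ≈⟨ ÷-cancel-inside (xFactor≉0 n) ⟩
      σ n n * ((1# - A * (P * P)) * (1# - x))
        ≈⟨ e-skeleton n n ⟨
      e n n ∎)
      where
      P = pow p n

    -- tⱼ · h n j no longer depends on x: it is the following term
    term : ℕ → ℕ → Carrier
    term n zero    = 1# ÷ (poch p p n * poch A p n)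
    term n (suc j) =
      (pow (- 1#) (suc j) * pow q (choose₂ (suc j)) * poch a q j * (1# - a * pow q (2 *ℕ suc j ∸ 1)))
      ÷ (poch q q (suc j) * poch p p (n ∸ suc j) * poch A p (n +ℕ suc j))

    termDen≉0 : ∀ n m → NonZero (poch q q (suc m) * poch p p (n ∸ suc m) * poch A p (n +ℕ suc m))
    termDen≉0 n m = *-nonZero (*-nonZero (poch-q≉0 (suc m)) (poch-p≉0 (n ∸ suc m))) (poch-A≉0 (n +ℕ suc m))

    -- cancelling (x;q²)_j, (a²/x;q²)_j and x^j between tⱼ and h(n,j)
    factor-step : ∀ n j → t j * h n j ≈ term n j
    factor-step n zero = begin
      1# * h n 0                               ≈⟨ *-identityˡ _ ⟩
      (1# * 1# * 1#) ÷ hDen n 0                ≈⟨ ÷-congˡ (trans (*-identityʳ _) (*-identityʳ _)) ⟩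
      1# ÷ (1# * poch p p n * poch A p (n +ℕ 0)) ≈⟨ ÷-congʳ (hDen≉0 n 0) den≈ ⟩
      term n 0                                 ∎
      where
      den≈ : 1# * poch p p n * poch A p (n +ℕ 0) ≈ poch p p n * poch A p n
      den≈ = *-cong (*-identityˡ _) (reflexive (≡.cong (poch A p) (ℕ.+-identityʳ n)))
    factor-step n (suc k) = begin
      t (suc k) * h n (suc k)        ≈⟨ ÷-*-÷ tDen≉0 (hDen≉0 n (suc k)) ⟩
      _ ÷ (_ * hDen n (suc k))       ≈⟨ ÷-≈ (*-nonZero tDen≉0 (hDen≉0 n (suc k))) (termDen≉0 n k) cross ⟩
      term n (suc k)                 ∎
      where
      L = 1# - a * pow q (2 *ℕ suc k ∸ 1)
      B = pow q (choose₂ (suc k))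
      S = pow (- 1#) (suc k)
      Xs = pow x (suc k)
      tDen≉0 : NonZero (pow q ((suc k *ℕ k) / 2) * Xs * poch q q (suc k) * poch w p (suc k))
      tDen≉0 = *-nonZero (*-nonZero (*-nonZero (pow-nonZero ((suc k *ℕ k) / 2) q≉0) (pow-nonZero (suc k) x≉0))
                                    (poch-q≉0 (suc k))) (poch-w≉0 (suc k))
      sign-split : pow (- x) (suc k) ≈ S * Xs
      sign-split = trans (pow-congˡ (suc k) (sym (-1*x≈-x x))) (pow-* (- 1#) x (suc k))
      square-split : pow q (suc k *ℕ suc k ∸ suc k) ≈ B * B
      square-split = trans (pow-cong q (square-minus (suc k))) (pow-+ q (choose₂ (suc k)) (choose₂ (suc k)))
      cross : L * poch a q k * poch x p (suc k) * gosperNum (suc k) * (poch q q (suc k) * poch p p (n ∸ suc k) * poch A p (n +ℕ suc k))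
              ≈ (S * B * poch a q k * L) * (pow q ((suc k *ℕ k) / 2) * Xs * poch q q (suc k) * poch w p (suc k) * hDen n (suc k))
      cross = begin
        _ ≈⟨ *-congʳ (*-congˡ (*-cong (*-congˡ sign-split) square-split)) ⟩
        L * poch a q k * poch x p (suc k) * (poch w p (suc k) * (S * Xs) * (B * B)) * (poch q q (suc k) * poch p p (n ∸ suc k) * poch A p (n +ℕ suc k))
          ≈⟨ solve 10 (λ L Ca Cx Cw S Xs B Cq C2 CA →
               L :* Ca :* Cx :* (Cw :* (S :* Xs) :* (B :* B)) :* (Cq :* C2 :* CA)
                 := (S :* B :* Ca :* L) :* (B :* Xs :* Cq :* Cw :* (Cx :* C2 :* CA))) refl _ _ _ _ _ _ _ _ _ _ ⟩
        (S * B * poch a q k * L) * (B * Xs * poch q q (suc k) * poch w p (suc k) * hDen n (suc k))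
          ≈⟨ *-congˡ (*-congʳ (*-congʳ (*-congʳ (*-congʳ (pow-cong q (halve k)))))) ⟨
        _ ∎

    Epoly : Carrier → Carrier → Carrier
    Epoly X′ Q = a * X′ * (q * q) * (Q * Q) + (1# + a * X′) * (q * Q) + X′ * (q * q)

    Epoly-cong : ∀ {X′ X″} Q → X′ ≈ X″ → Epoly X′ Q ≈ Epoly X″ Q
    Epoly-cong Q e = +-cong (+-cong (*-congʳ (*-congʳ (*-congˡ e))) (*-congʳ (+-congˡ (*-congˡ e)))) (*-congʳ e)

    cert : ℕ → ℕ → Carrier
    cert n zero    = 0#
    cert n (suc m) = (pow (- 1#) m * pow q (choose₂ m) * poch a q m * Epoly (X n) (pow q m))
                     ÷ (q * poch q q m * poch p p (n ∸ m) * poch A p (n +ℕ suc m))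

    sPoly : Carrier → Carrier
    sPoly X′ = (1# - (- a) * X′) * (1# - (- a) * (q * X′)) * (1# - p * X′)

    sPoly-cong : ∀ {X′ X″} → X′ ≈ X″ → sPoly X′ ≈ sPoly X″
    sPoly-cong e = *-cong (*-cong (one-minus-cong e) (one-minus-cong (*-congˡ e))) (one-minus-cong e)

    -- coefficients of the recurrence s n Σₙ₊₁ = - c n Σₙ
    s c : ℕ → Carrier
    s n = sPoly (X n)
    c n = q * X n

    s≉0 : ∀ n → NonZero (s n)
    s≉0 n = *-nonZero (*-nonZero (-aFactor≉0 (2 *ℕ n)) (-aFactor≉0 (suc (2 *ℕ n))))
                      (nonZero-resp (one-minus-cong (sym (X≈pow-p n))) (pFactor≉0 n))

    β : ℕ → Carrier
    β n = (pow (- 1#) n * pow q (n *ℕ n)) ÷ (poch (- a) q (2 *ℕ n) * poch p p n)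

    βDen≉0 : ∀ n → NonZero (poch (- a) q (2 *ℕ n) * poch p p n)
    βDen≉0 n = *-nonZero (poch--a≉0 (2 *ℕ n)) (poch-p≉0 n)

    κDen : ℕ → ℕ → Carrier
    κDen n m = q * poch q q (suc m) * poch p p (n ∸ m) * poch A p (suc (n +ℕ suc m))

    κ : ℕ → ℕ → Carrier
    κ n m = (pow (- 1#) m * pow q (choose₂ m) * poch a q m) ÷ κDen n m

    κ₀ : ℕ → Carrier
    κ₀ n = 1# ÷ (q * poch p p (suc n) * poch A p (suc n))

    κDen≉0 : ∀ n m → NonZero (κDen n m)
    κDen≉0 n m = *-nonZero (*-nonZero (*-nonZero q≉0 (poch-q≉0 (suc m))) (poch-p≉0 (n ∸ m))) (poch-A≉0 (suc (n +ℕ suc m)))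

    certDen≉0 : ∀ n m → NonZero (q * poch q q m * poch p p (n ∸ m) * poch A p (n +ℕ suc m))
    certDen≉0 n m = *-nonZero (*-nonZero (*-nonZero q≉0 (poch-q≉0 m)) (poch-p≉0 (n ∸ m))) (poch-A≉0 (n +ℕ suc m))

    -- The four terms of the WZ identity at j = m+1 as multiples of κ n m,
    -- in the variables Q = q^m and Y = q^{2(n-m)}, so that q^{2n} = Q²Y.
    module WZSkeleton (n m : ℕ) (m≤n : m ≤ n) where
      Q Y X′ Z′ L : Carrier
      Q  = pow q m
      Y  = pow p (n ∸ m)
      X′ = (Q * Q) * Y
      Z′ = X′ * ((q * q) * (Q * Q))
      L  = 1# - a * (q * (Q * Q))

      -- κ n m times u₁, u₀, g₁, g₂ is term (n+1) (m+1), term n (m+1),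
      -- cert n (m+1) and cert n (m+2) respectively
      u₁ u₀ g₁ g₂ : Carrier
      u₁ = (- Q * L) * q
      u₀ = (- Q * L) * ((1# - Y) * (q * (1# - A * Z′)))
      g₁ = Epoly X′ Q * ((1# - q * Q) * (1# - A * Z′))
      g₂ = (- 1# * Q * (1# - a * Q) * Epoly X′ (q * Q)) * (1# - Y)

      S T Ca : Carrier
      S  = pow (- 1#) m
      T  = pow q (choose₂ m)
      Ca = poch a q m

      pow-p-n : pow p n ≈ X′
      pow-p-n = trans (pow-split p m≤n) (*-congʳ (pow-* q q m))

      X-split : X n ≈ X′
      X-split = trans (X≈pow-p n) pow-p-n

      Z-split : pow p (n +ℕ suc m) ≈ Z′
      Z-split = trans (pow-+ p n (suc m)) (*-cong pow-p-n (*-congˡ (pow-* q q m)))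

      term-num≈ : pow (- 1#) (suc m) * pow q (choose₂ (suc m)) * Ca * (1# - a * pow q (2 *ℕ suc m ∸ 1))
                  ≈ S * T * Ca * (- Q * L)
      term-num≈ = begin
        - 1# * S * pow q (m +ℕ choose₂ m) * Ca * (1# - a * pow q (2 *ℕ suc m ∸ 1))
          ≈⟨ *-cong (*-congʳ (*-congˡ (pow-+ q m (choose₂ m))))
                    (one-minus-cong (trans (pow-cong q (odd m)) (*-congˡ (pow-+ q m m)))) ⟩
        - 1# * S * (Q * T) * Ca * L
          ≈⟨ solve 5 (λ S Q T Ca L → :- :1 :* S :* (Q :* T) :* Ca :* L := S :* T :* Ca :* (:- Q :* L)) refl
                     S Q T Ca L ⟩
        S * T * Ca * (- Q * L) ∎

      term-upper : term (suc n) (suc m) ≈ κ n m * u₁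
      term-upper = ÷-factor (termDen≉0 (suc n) m) (κDen≉0 n m) term-num≈
        (solve 4 (λ q Cq P2 CA → q :* Cq :* P2 :* CA := (Cq :* P2 :* CA) :* q) refl
               q (poch q q (suc m)) (poch p p (n ∸ m)) (poch A p (suc (n +ℕ suc m))))

      cert-lower : cert n (suc m) ≈ κ n m * g₁
      cert-lower = ÷-factor (certDen≉0 n m) (κDen≉0 n m) (*-congˡ (Epoly-cong Q X-split)) den≈
        where
        den≈ : κDen n m ≈ q * poch q q m * poch p p (n ∸ m) * poch A p (n +ℕ suc m)
                          * ((1# - q * Q) * (1# - A * Z′))
        den≈ = trans (*-congˡ (*-congˡ (one-minus-cong Z-split)))
          (solve 6 (λ q Cq lq P2 CA lA → q :* (Cq :* lq) :* P2 :* (CA :* lA)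
                                       := (q :* Cq :* P2 :* CA) :* (lq :* lA)) refl
                 q (poch q q m) (1# - q * Q) (poch p p (n ∸ m)) (poch A p (n +ℕ suc m)) (1# - A * Z′))

      module _ (m<n : m < n) where
        term-lower : term n (suc m) ≈ κ n m * u₀
        term-lower = ÷-factor (termDen≉0 n m) (κDen≉0 n m) term-num≈ den≈
          where
          den≈ : κDen n m ≈ poch q q (suc m) * poch p p (n ∸ suc m) * poch A p (n +ℕ suc m)
                            * ((1# - Y) * (q * (1# - A * Z′)))
          den≈ = trans (*-cong (*-congˡ (poch-p-peel m<n)) (*-congˡ (one-minus-cong Z-split)))
            (solve 6 (λ q Cq P2 lY CA lA → q :* Cq :* (P2 :* lY) :* (CA :* lA)
                                         := (Cq :* P2 :* CA) :* (lY :* (q :* lA))) refl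
                   q (poch q q (suc m)) (poch p p (n ∸ suc m)) (1# - Y) (poch A p (n +ℕ suc m)) (1# - A * Z′))

        cert-upper : cert n (suc (suc m)) ≈ κ n m * g₂
        cert-upper = ÷-factor (certDen≉0 n (suc m)) (κDen≉0 n m) num≈ den≈
          where
          num≈ : - 1# * S * pow q (m +ℕ choose₂ m) * (Ca * (1# - a * Q)) * Epoly (X n) (q * Q)
                 ≈ S * T * Ca * (- 1# * Q * (1# - a * Q) * Epoly X′ (q * Q))
          num≈ = trans (*-cong (*-congʳ (*-congˡ (pow-+ q m (choose₂ m)))) (Epoly-cong (q * Q) X-split))
            (solve 6 (λ S Q T Ca la E → :- :1 :* S :* (Q :* T) :* (Ca :* la) :* E
                                      := S :* T :* Ca :* (:- :1 :* Q :* la :* E)) refl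
                   S Q T Ca (1# - a * Q) (Epoly X′ (q * Q)))
          den≈ : κDen n m ≈ q * poch q q (suc m) * poch p p (n ∸ suc m) * poch A p (n +ℕ suc (suc m)) * (1# - Y)
          den≈ = trans (*-cong (*-congˡ (poch-p-peel m<n)) (reflexive (≡.cong (poch A p) (≡.sym (ℕ.+-suc n (suc m))))))
            (solve 5 (λ q Cq P2 lY CA → q :* Cq :* (P2 :* lY) :* CA := (q :* Cq :* P2 :* CA) :* lY) refl
                   q (poch q q (suc m)) (poch p p (n ∸ suc m)) (1# - Y) (poch A p (n +ℕ suc (suc m))))

    wz-identity : ∀ Q Y →
      let X′ = (Q * Q) * Y ; Z′ = X′ * ((q * q) * (Q * Q)) ; L = 1# - a * (q * (Q * Q)) in
      sPoly X′ * ((- Q * L) * q) + (q * X′) * ((- Q * L) * ((1# - Y) * (q * (1# - A * Z′))))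
        ≈ (- 1# * Q * (1# - a * Q) * Epoly X′ (q * Q)) * (1# - Y)
          - Epoly X′ Q * ((1# - q * Q) * (1# - A * Z′))
    wz-identity = solve 4 (λ a q Q Y →
      let X′ = (Q :* Q) :* Y ; Z′ = X′ :* ((q :* q) :* (Q :* Q)) ; L = :1 :- a :* (q :* (Q :* Q))
          E = λ X Q → a :* X :* (q :* q) :* (Q :* Q) :+ (:1 :+ a :* X) :* (q :* Q) :+ X :* (q :* q)
          sP = (:1 :- (:- a) :* X′) :* (:1 :- (:- a) :* (q :* X′)) :* (:1 :- (q :* q) :* X′) in
      sP :* ((:- Q :* L) :* q) :+ (q :* X′) :* ((:- Q :* L) :* ((:1 :- Y) :* (q :* (:1 :- (a :* a) :* Z′))))
        := (:- :1 :* Q :* (:1 :- a :* Q) :* E X′ (q :* Q)) :* (:1 :- Y)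
           :- E X′ Q :* ((:1 :- q :* Q) :* (:1 :- (a :* a) :* Z′))) refl a q

    wz-identity₀ : ∀ X′ →
      sPoly X′ * q + (q * X′) * (q * ((1# - p * X′) * (1# - A * X′))) ≈ Epoly X′ 1# * (1# - p * X′)
    wz-identity₀ = solve 3 (λ a q X →
      let E = a :* X :* (q :* q) :* (:1 :* :1) :+ (:1 :+ a :* X) :* (q :* :1) :+ X :* (q :* q)
          sP = (:1 :- (:- a) :* X) :* (:1 :- (:- a) :* (q :* X)) :* (:1 :- (q :* q) :* X) in
      sP :* q :+ (q :* X) :* (q :* ((:1 :- (q :* q) :* X) :* (:1 :- (a :* a) :* X)))
        := E :* (:1 :- (q :* q) :* X)) refl a q

    pull-out : ∀ s κ u c v → s * (κ * u) + c * (κ * v) ≈ κ * (s * u + c * v)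
    pull-out = solve 5 (λ s κ u c v → s :* (κ :* u) :+ c :* (κ :* v) := κ :* (s :* u :+ c :* v)) refl

    wz-step : ∀ n j → j ≤ n → s n * term (suc n) j + c n * term n j ≈ cert n (suc j) - cert n j
    wz-step n zero _ = begin
      s n * term (suc n) 0 + c n * term n 0
        ≈⟨ +-cong (*-congˡ upper) (*-congˡ lower) ⟩
      s n * (κ₀ n * q) + c n * (κ₀ n * (q * ((1# - p * X n) * (1# - A * X n))))
        ≈⟨ pull-out _ _ _ _ _ ⟩
      κ₀ n * (s n * q + c n * (q * ((1# - p * X n) * (1# - A * X n))))
        ≈⟨ *-congˡ (wz-identity₀ (X n)) ⟩
      κ₀ n * (Epoly (X n) 1# * (1# - p * X n))
        ≈⟨ certificate ⟨
      cert n 1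
        ≈⟨ trans (+-congˡ -0#≈0#) (+-identityʳ _) ⟨
      cert n 1 - 0# ∎
      where
      κ₀Den≉0 = *-nonZero (*-nonZero q≉0 (poch-p≉0 (suc n))) (poch-A≉0 (suc n))
      pow-p≈X = sym (X≈pow-p n)
      upper : term (suc n) 0 ≈ κ₀ n * q
      upper = ÷-extend (*-nonZero (poch-p≉0 (suc n)) (poch-A≉0 (suc n))) κ₀Den≉0
        (solve 3 (λ q P2 PA → q :* P2 :* PA := (P2 :* PA) :* q) refl q (poch p p (suc n)) (poch A p (suc n)))
      lower : term n 0 ≈ κ₀ n * (q * ((1# - p * X n) * (1# - A * X n)))
      lower = ÷-extend (*-nonZero (poch-p≉0 n) (poch-A≉0 n)) κ₀Den≉0
        (trans (*-cong (*-congˡ (*-congˡ (one-minus-cong pow-p≈X))) (*-congˡ (one-minus-cong pow-p≈X)))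
               (solve 5 (λ q P2 lp PA lA → q :* (P2 :* lp) :* (PA :* lA) := (P2 :* PA) :* (q :* (lp :* lA))) refl
                      q (poch p p n) (1# - p * X n) (poch A p n) (1# - A * X n)))
      certificate : cert n 1 ≈ κ₀ n * (Epoly (X n) 1# * (1# - p * X n))
      certificate = ÷-factor (certDen≉0 n 0) κ₀Den≉0 (*-congʳ (trans (*-identityʳ _) (*-identityʳ _)))
        (trans (*-cong (*-congˡ (*-congˡ (one-minus-cong pow-p≈X))) (reflexive (≡.cong (poch A p) (ℕ.+-comm 1 n))))
               (solve 4 (λ q P2 lp PA → q :* (P2 :* lp) :* PA := (q :* :1 :* P2 :* PA) :* lp) refl
                      q (poch p p n) (1# - p * X n) (poch A p (n +ℕ 1))))
    wz-step n (suc m) m<n = begin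
      s n * term (suc n) (suc m) + c n * term n (suc m)
        ≈⟨ +-cong (*-cong (sPoly-cong X-split) term-upper) (*-cong (*-congˡ X-split) (term-lower m<n)) ⟩
      sPoly X′ * (κ n m * u₁) + (q * X′) * (κ n m * u₀)  ≈⟨ pull-out _ _ _ _ _ ⟩
      κ n m * (sPoly X′ * u₁ + (q * X′) * u₀)           ≈⟨ *-congˡ (wz-identity Q Y) ⟩
      κ n m * (g₂ - g₁)                                 ≈⟨ x[y-z]≈xy-xz (κ n m) g₂ g₁ ⟩
      κ n m * g₂ - κ n m * g₁                           ≈⟨ +-cong (cert-upper m<n) (-‿cong cert-lower) ⟨
      cert n (suc (suc m)) - cert n (suc m)             ∎
      where open WZSkeleton n m (ℕ.<⇒≤ m<n)

    -- at j = n+1 the same identity holds with Y = 1, which kills two terms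
    wz-top : ∀ n → s n * term (suc n) (suc n) ≈ - cert n (suc n)
    wz-top n = begin
      s n * term (suc n) (suc n)    ≈⟨ *-cong (sPoly-cong X-split) term-upper ⟩
      sPoly X′ * (κ n n * u₁)        ≈⟨ x∙yz≈y∙xz (sPoly X′) (κ n n) u₁ ⟩
      κ n n * (sPoly X′ * u₁)        ≈⟨ *-congˡ (drop-vanishing (wz-identity Q Y) u₀≈0 g₂≈0) ⟩
      κ n n * - g₁                  ≈⟨ -‿distribʳ-* (κ n n) g₁ ⟨
      - (κ n n * g₁)                ≈⟨ -‿cong cert-lower ⟨
      - cert n (suc n)              ∎
      where
      open WZSkeleton n n ℕ.≤-refl
      1-Y≈0 : 1# - Y ≈ 0#
      1-Y≈0 = trans (+-congˡ (-‿cong (pow-cong p (ℕ.n∸n≡0 n)))) (-‿inverseʳ 1#)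
      u₀≈0 : u₀ ≈ 0#
      u₀≈0 = trans (*-congˡ (trans (*-congʳ 1-Y≈0) (zeroˡ _))) (zeroʳ _)
      g₂≈0 : g₂ ≈ 0#
      g₂≈0 = trans (*-congˡ 1-Y≈0) (zeroʳ _)
      drop-vanishing : ∀ {v c w g₂ g₁} → v + c * w ≈ g₂ - g₁ → w ≈ 0# → g₂ ≈ 0# → v ≈ - g₁
      drop-vanishing {v} {c} {w} {g₂} {g₁} identity w≈0 g₂≈0 = begin
        v                          ≈⟨ solve 3 (λ v c w → v := (v :+ c :* w) :- c :* w) refl v c w ⟩
        (v + c * w) - c * w        ≈⟨ +-cong identity (-‿cong (*-congˡ w≈0)) ⟩
        (g₂ - g₁) - c * 0#         ≈⟨ +-congʳ (+-congʳ g₂≈0) ⟩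
        (0# - g₁) - c * 0#         ≈⟨ solve 2 (λ g c → (con (+ 0) :- g) :- c :* con (+ 0) := :- g) refl g₁ c ⟩
        - g₁                       ∎

    β-step : ∀ n → s n * β (suc n) ≈ - (c n * β n)
    β-step n = begin
      s n * β (suc n)                   ≈⟨ *-assoc (s n) _ _ ⟨
      (s n * N′) ÷ D′                   ≈⟨ ÷-≈ (βDen≉0 (suc n)) (βDen≉0 n) cross ⟩
      (- (c n * N)) ÷ D                 ≈⟨ solve 3 (λ c N d → :- (c :* N) :* d := :- (c :* (N :* d))) refl (c n) N (D ⁻¹) ⟩
      - (c n * β n)                     ∎
      where
      N = pow (- 1#) n * pow q (n *ℕ n)
      D = poch (- a) q (2 *ℕ n) * poch p p n
      N′ = pow (- 1#) (suc n) * pow q (suc n *ℕ suc n)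
      D′ = poch (- a) q (2 *ℕ suc n) * poch p p (suc n)
      square-suc : ∀ n → suc n *ℕ suc n ≡ n *ℕ n +ℕ suc (2 *ℕ n)
      square-suc = solve-∀
      double-suc : ∀ n → 2 *ℕ suc n ≡ suc (suc (2 *ℕ n))
      double-suc = solve-∀
      cross : s n * N′ * D ≈ - (c n * N) * D′
      cross = begin
        s n * (- 1# * pow (- 1#) n * pow q (suc n *ℕ suc n)) * D
          ≈⟨ *-congʳ (*-congˡ (*-congˡ (trans (pow-cong q (square-suc n)) (pow-+ q (n *ℕ n) _)))) ⟩
        s n * (- 1# * pow (- 1#) n * (pow q (n *ℕ n) * (q * X n))) * D
          ≈⟨ solve 9 (λ l₁ l₂ l₃ S Q2 q X Cm P2 →
               l₁ :* l₂ :* l₃ :* (:- :1 :* S :* (Q2 :* (q :* X))) :* (Cm :* P2)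
                 := :- ((q :* X) :* (S :* Q2)) :* ((Cm :* l₁ :* l₂) :* (P2 :* l₃))) refl
               (1# - (- a) * X n) (1# - (- a) * (q * X n)) (1# - p * X n)
               (pow (- 1#) n) (pow q (n *ℕ n)) q (X n) (poch (- a) q (2 *ℕ n)) (poch p p n) ⟩
        - (c n * N) * ((poch (- a) q (2 *ℕ n) * (1# - (- a) * X n) * (1# - (- a) * (q * X n)))
                       * (poch p p n * (1# - p * X n)))
          ≈⟨ *-congˡ (*-cong (reflexive (≡.cong (poch (- a) q) (≡.sym (double-suc n))))
                             (*-congˡ (one-minus-cong (X≈pow-p n)))) ⟩
        - (c n * N) * D′ ∎

    term-sum : ∀ n → sumTo n (term n) ≈ β n
    term-sum zero    = ÷-congˡ (sym (*-identityʳ 1#))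
    term-sum (suc n) = *-cancelˡ (s≉0 n) (begin
      s n * sumTo (suc n) (term (suc n))
        ≈⟨ creative-telescoping n (term n) (term (suc n)) (cert n) (s n) (c n) (wz-step n) refl (wz-top n) ⟩
      - (c n * sumTo n (term n))        ≈⟨ -‿cong (*-congˡ (term-sum n)) ⟩
      - (c n * β n)                     ≈⟨ β-step n ⟨
      s n * β (suc n)                   ∎)

    bailey : ∀ n → beta' a x q n ≈ sumTo n (λ i → alpha' a x q i ÷ baileyDen n i)
    bailey n = sym (begin
      sumTo n (λ i → alpha' a x q i ÷ baileyDen n i)  ≈⟨ sum-cong n (λ i _ → summand≈ n i) ⟩
      sumTo n (λ i → sumTo i t * e n i)
        ≈⟨ summation-by-parts n t (e n) (λ i → r n * h n i)
             (λ i i<n → trans (gosper-step n i i<n) (x[y-z]≈xy-xz (r n) _ _)) (gosper-top n) ⟩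
      sumTo n (λ i → t i * (r n * h n i))             ≈⟨ sum-cong n (λ i _ → x∙yz≈y∙xz (t i) (r n) (h n i)) ⟩
      sumTo n (λ i → r n * (t i * h n i))             ≈⟨ sum-cong n (λ i _ → *-congˡ (factor-step n i)) ⟩
      sumTo n (λ i → r n * term n i)                  ≈⟨ sum-*ˡ n (r n) (term n) ⟩
      r n * sumTo n (term n)                          ≈⟨ *-congˡ (term-sum n) ⟩
      r n * β n                                       ≈⟨ *-comm (r n) (β n) ⟩
      β n * r n                                       ≈⟨ ÷-*-÷ (βDen≉0 n) (xFactor≉0 n) ⟩
      beta' a x q n                                   ∎)

theorem2p1 : {c ℓ : Level} (F : Field c ℓ) → let open FieldOps F in
    (a x q : Carrier) →
    ¬ (q ≈ 0#) →
    ¬ (x ≈ 0#) →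
    ¬ (1# - sq a ≈ 0#) →
    (∀ k → ¬ (1# - (sq q * x) * pow (sq q) k ≈ 0#)) →
    (∀ n → ¬ (1# - x * pow q (2 *ℕ n) ≈ 0#)) →
    (∀ k → ¬ (1# - q * pow q k ≈ 0#)) →
    (∀ k → ¬ (1# - sq q * pow (sq q) k ≈ 0#)) →
    (∀ k → ¬ (1# - (sq a ÷ x) * pow (sq q) k ≈ 0#)) →
    (∀ k → ¬ (1# - (- a) * pow q k ≈ 0#)) →
    (∀ k → ¬ (1# - (sq a * sq q) * pow (sq q) k ≈ 0#)) →
    BaileyPair (sq a) (sq q) (alpha' a x q) (beta' a x q)
theorem2p1 F = BaileyPairProof.bailey F
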